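{- If $G$ is a connected graph with $\operatorname{diam}(G)=k\ge 2$, then $\mathrm{gp}_{\rm o}(G)\ge \alpha_{k-1}(G)$.
   Context: All graphs are finite and simple. For $X\subseteq V(G)$, two vertices $u,v$ are $X$-positionable if no shortest $u,v$-path in $G$ has an internal vertex in $X$. $X$ is an outer general position set if every two vertices of $X$ are $X$-positionable and every $u\in X$, $v\in V(G)\setminus X$ are $X$-positionable; $\mathrm{gp}_{\rm o}(G)$ is the maximum cardinality of an outer general position set. For $j\ge1$, a set $X$ is $j$-independent if $d_G(u,v)>j$ for all distinct $u,v\in X$, and $\alpha_j(G)$ is the maximum cardinality of a $j$-independent set. -}

module Defs where

open import Data.Nat using (ℕ; zero; suc; _≤_; _<_; _>_)
open import Data.Fin using (Fin)
open import Data.Fin.Subset using (Subset; _∈_; _∉_; ∣_∣)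
open import Data.Product using (Σ; _×_; _,_; ∃-syntax)
open import Data.Empty using (⊥)
open import Relation.Nullary using (¬_)
open import Relation.Binary.PropositionalEquality using (_≡_)

record Graph (n : ℕ) : Set₁ where
  field
    Adj     : Fin n → Fin n → Set
    sym     : ∀ {u v} → Adj u v → Adj v u
    irrefl  : ∀ {u} → ¬ Adj u u

open Graph public

data Walk {n : ℕ} (G : Graph n) : Fin n → Fin n → ℕ → Set where
  [] : ∀ {u} → Walk G u u zero
  _∷_ : ∀ {u w v ℓ} → Adj G u w → Walk G w v ℓ → Walk G u v (suc ℓ)

-- x is an internal vertex of the walk (neither the first nor the last vertex
-- in the sequence of positions; for a shortest path, vertices are distinct).
data Internal {n : ℕ} {G : Graph n} (x : Fin n) :
     ∀ {u v ℓ} → Walk G u v ℓ → Set where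
  here  : ∀ {u v ℓ} (e : Adj G u x) (p : Walk G x v (suc ℓ)) → Internal x (e ∷ p)
  there : ∀ {u w v ℓ} (e : Adj G u w) {p : Walk G w v ℓ} → Internal x p → Internal x (e ∷ p)

Dist : {n : ℕ} → Graph n → Fin n → Fin n → ℕ → Set
Dist G u v d = Walk G u v d × (∀ {ℓ} → Walk G u v ℓ → d ≤ ℓ)

Connected : {n : ℕ} → Graph n → Set
Connected G = ∀ u v → ∃[ ℓ ] Walk G u v ℓ

Diameter : {n : ℕ} → Graph n → ℕ → Set
Diameter G k = (∀ u v d → Dist G u v d → d ≤ k) × (∃[ u ] ∃[ v ] Dist G u v k)

Positionable : {n : ℕ} → Graph n → Subset n → Fin n → Fin n → Set
Positionable G X u v =
  ∀ d (p : Walk G u v d) → Dist G u v d → ∀ x → x ∈ X → ¬ Internal x p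

OuterGP : {n : ℕ} → Graph n → Subset n → Set
OuterGP G X =
  (∀ u v → u ∈ X → v ∈ X → Positionable G X u v) ×
  (∀ u v → u ∈ X → v ∉ X → Positionable G X u v)

Independent : {n : ℕ} → Graph n → ℕ → Subset n → Set
Independent G j X =
  ∀ u v → u ∈ X → v ∈ X → ¬ u ≡ v → ∀ d → Dist G u v d → d > j

{-# OPTIONS --safe #-}
module Submission where

open import Defs
open import Data.Nat using (ℕ; suc; zero; _≤_; _+_; z≤n; s≤s)
open import Data.Nat.Properties using (≤-refl; ≤-trans; <-≤-trans; <-irrefl; +-cancelʳ-≤; m<m+n)
open import Data.Fin.Subset using (Subset; ∣_∣; _∈_)
open import Data.Product using (_×_; ∃-syntax; _,_; proj₁)
open import Relation.Nullary using (¬_)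
open import Relation.Binary.PropositionalEquality using (_≡_; refl)

-- The set X itself works: a shortest u,v-path with u ∈ X through an internal
-- x ∈ X has a prefix that is a shortest u,x-path, of length ≥ j + 1 by
-- independence, so the path is longer than the diameter j + 1.

module _ {n} {G : Graph n} where

  _++ʷ_ : ∀ {u w v a b} → Walk G u w a → Walk G w v b → Walk G u v (a + b)
  []      ++ʷ q = q
  (e ∷ p) ++ʷ q = e ∷ (p ++ʷ q)

  split-at-internal : ∀ {x u v ℓ} {p : Walk G u v ℓ} → Internal x p →
    ∃[ a ] ∃[ b ] (Walk G u x (suc a) × Walk G x v (suc b) × suc a + suc b ≡ ℓ)
  split-at-internal (here e p) = zero , _ , e ∷ [] , p , refl
  split-at-internal (there e i) with split-at-internal i
  ... | a , b , p , q , refl = suc a , b , e ∷ p , q , refl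

  shortest-prefix : ∀ {u x v a b} → Walk G u x a → Walk G x v b →
    Dist G u v (a + b) → Dist G u x a
  shortest-prefix {b = b} p q (_ , shortest) =
    p , λ {ℓ} p′ → +-cancelʳ-≤ b _ ℓ (shortest (p′ ++ʷ q))

  dist-refl-zero : ∀ {u d} → Dist G u u d → d ≡ zero
  dist-refl-zero (_ , shortest) with shortest []
  ... | z≤n = refl

  independent⇒positionable : ∀ {j} → (∀ u v d → Dist G u v d → d ≤ suc j) →
    ∀ {X} → Independent G j X → ∀ u v → u ∈ X → Positionable G X u v
  independent⇒positionable bounded independent u v u∈X d p uv x x∈X i
    with split-at-internal i
  ... | a , b , p₁ , p₂ , refl = <-irrefl refl (<-≤-trans (m<m+n (suc a) (s≤s z≤n)) too-short)
    where
    ux : Dist G u x (suc a)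
    ux = shortest-prefix p₁ p₂ uv

    u≢x : ¬ u ≡ x
    u≢x refl with dist-refl-zero ux
    ... | ()

    too-short : suc a + suc b ≤ suc a
    too-short = ≤-trans (bounded u v _ uv) (independent u x u∈X x∈X u≢x (suc a) ux)

  independent⇒outerGP : ∀ {j} → (∀ u v d → Dist G u v d → d ≤ suc j) →
    ∀ {X} → Independent G j X → OuterGP G X
  independent⇒outerGP bounded independent =
    (λ u v u∈X _ → independent⇒positionable bounded independent u v u∈X) ,
    (λ u v u∈X _ → independent⇒positionable bounded independent u v u∈X)

proposition3p3 : ∀ {n} (G : Graph n) (j : ℕ) → Connected G → 1 ≤ j →
    Diameter G (suc j) →
    ∀ (X : Subset n) → Independent G j X →
    ∃[ Y ] (OuterGP G Y × ∣ X ∣ ≤ ∣ Y ∣)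
proposition3p3 G j _ _ diameter X independent =
  X , independent⇒outerGP (proj₁ diameter) independent , ≤-refl
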